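{- Let $\rho$ be an integer polymatroid on a finite set $E$, and suppose $M_1,M_2,\ldots,M_k$ are matroids on $E$ with $\rho(X)=r_{M_1}(X)+r_{M_2}(X)+\cdots+r_{M_k}(X)$ for all $X\subseteq E$. Let $X_i$ ($i\in E$), $X_A$ ($A\subseteq E$) and $E'=X_E$ be as in the construction of the natural matroid $M_\rho$. For each $j\in[k]$, construct the matroid $M'_j$ on $E'$ from $M_j$ by, for each $i\in E$, adding the elements of $X_i$ parallel to $i$ (or as loops if $r_{M_j}(\{i\})=0$), and then deleting $i$. Then the natural matroid $M_\rho$ equals the matroid union $M'_1\vee M'_2\vee\cdots\vee M'_k$.
   Context: An integer polymatroid on a finite set $E$ is a function $\rho:2^E\to\mathbb{N}$ with $\rho(\emptyset)=0$, $\rho(A)\le\rho(B)$ whenever $A\subseteq B$, and $\rho(A\cup B)+\rho(A\cap B)\le\rho(A)+\rho(B)$ for all $A,B\subseteq E$. Its natural matroid $M_\rho$ is constructed as follows: for each $i\in E$ let $X_i$ be a set of $\rho(\{i\})$ elements, the sets $X_i$ being pairwise disjoint; for $A\subseteq E$ put $X_A=\bigcup_{i\in A}X_i$, and $E'=X_E$. Then $M_\rho$ is the matroid on $E'$ with rank function $r(Y)=\min\{\rho(A)+|Y-X_A| : A\subseteq E\}$ for $Y\subseteq E'$ (equivalently, its independent sets are the $I\subseteq E'$ with $|I\cap X_A|\le\rho(A)$ for all $A\subseteq E$). The matroid union $N_1\vee\cdots\vee N_k$ of matroids on a common ground set $S$ is the matroid on $S$ whose independent sets are the sets $I_1\cup\cdots\cup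 I_k$ with $I_j$ independent in $N_j$. $[k]=\{1,\ldots,k\}$. -}

module Defs where

open import Data.Nat using (ℕ; _+_; _≤_)
open import Data.Bool using (if_then_else_)
open import Data.Fin using (Fin)
open import Data.Fin.Subset using (Subset; ⊥; ⊤; ⁅_⁆; _∈_; _⊆_; _∩_; _∪_; _─_; ⋃; ∣_∣)
open import Data.Vec using (lookup; tabulate)
open import Data.List using (List)
open import Data.Nat.ListAction using (sum)
import Data.List as List
open import Data.Product using (Σ; _×_)
open import Relation.Binary.PropositionalEquality using (_≡_)

record IsIntPolymatroid {n : ℕ} (ρ : Subset n → ℕ) : Set where
  field
    normalized : ρ ⊥ ≡ 0
    monotone   : ∀ A B → A ⊆ B → ρ A ≤ ρ B
    submodular : ∀ A B → ρ (A ∪ B) + ρ (A ∩ B) ≤ ρ A + ρ B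

record Matroid (m : ℕ) : Set where
  field
    rank       : Subset m → ℕ
    rank-bound : ∀ X → rank X ≤ ∣ X ∣
    rank-mono  : ∀ X Y → X ⊆ Y → rank X ≤ rank Y
    rank-submod : ∀ X Y → rank (X ∪ Y) + rank (X ∩ Y) ≤ rank X + rank Y

open Matroid public

Indep : ∀ {m} → Matroid m → Subset m → Set
Indep M I = rank M I ≡ ∣ I ∣

sumFin : (k : ℕ) → (Fin k → ℕ) → ℕ
sumFin k f = sum (List.tabulate f)

unionFin : ∀ {m} (k : ℕ) → (Fin k → Subset m) → Subset m
unionFin k f = ⋃ (List.tabulate f)

-- The new ground set E' is Fin m together with a map π : Fin m → Fin n,
-- where X_i = π⁻¹(i).  X_A = π⁻¹(A):
preimage : ∀ {m n} → (Fin m → Fin n) → Subset n → Subset m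
preimage π A = tabulate (λ y → lookup A (π y))

image : ∀ {m n} → (Fin m → Fin n) → Subset m → Subset n
image {m} π Y = ⋃ (List.tabulate (λ y → if lookup Y y then ⁅ π y ⁆ else ⊥))

IsNaturalGround : ∀ {m n} → (Subset n → ℕ) → (Fin m → Fin n) → Set
IsNaturalGround {n = n} ρ π = ∀ (i : Fin n) → ∣ preimage π ⁅ i ⁆ ∣ ≡ ρ ⁅ i ⁆

IndepNatural : ∀ {m n} → (Subset n → ℕ) → (Fin m → Fin n) → Subset m → Set
IndepNatural ρ π I = ∀ A → ∣ I ∩ preimage π A ∣ ≤ ρ A

InjectiveOn : ∀ {m n} → (Fin m → Fin n) → Subset m → Set
InjectiveOn π I = ∀ x y → x ∈ I → y ∈ I → π x ≡ π y → x ≡ y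

-- Independent sets of M' (M with each i replaced by the parallel class X_i,
-- loops if i is a loop, then i deleted): I is independent iff it meets each
-- X_i in at most one element and π(I) is independent in M.
IndepParallel : ∀ {m n} → Matroid n → (Fin m → Fin n) → Subset m → Set
IndepParallel M π I = InjectiveOn π I × Indep M (image π I)

IndepUnion : ∀ {m n} (k : ℕ) → (Fin k → Matroid n) → (Fin m → Fin n) → Subset m → Set
IndepUnion {m} k M π I =
  Σ (Fin k → Subset m) (λ J → ((j : Fin k) → IndepParallel (M j) π (J j)) × (unionFin k J ≡ I))

-- An independent set of M'_j meets X_A in at most r_{M_j}(A) elements, so a union of such
-- sets meets X_A in at most Σ_j r_{M_j}(A) = ρ(A) elements.  Conversely, M'_j is the matroid
-- with rank Y ↦ r_{M_j}(π Y), where π : E' → E collapses each X_i to i, and an M_ρ-independent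
-- set I satisfies Rado's condition |P| ≤ Σ_j r_{M'_j}(P) for every P ⊆ I (take A = π P).
-- Rado's theorem, proved by Welsh's argument, then splits I into sets independent in the M'_j.
module Submission where

open import Defs
open import Data.Nat using (ℕ; zero; suc; _+_; _≤_; _<_; z≤n; s≤s; _≤?_)
import Data.Nat.Properties as ℕ
open import Data.Nat.Properties using (≤-refl; ≤-trans; ≤-antisym; ≤-reflexive; +-mono-≤)
open import Data.Nat.Induction using (<-wellFounded)
open import Algebra.Properties.CommutativeSemigroup ℕ.+-commutativeSemigroup using (interchange)
open import Data.Fin using (Fin; zero; suc; _≟_)
open import Data.Fin.Properties using (any?; suc-injective)
open import Data.Fin.Subset
  using (Subset; inside; outside; ⊥; ⊤; ⁅_⁆; _∈_; _∉_; _⊆_; _∩_; _∪_; _─_; _-_; ∣_∣; Empty)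
open import Data.Fin.Subset.Properties
  using ( ∉⊥; ∣⊥∣≡0; x∈⁅x⁆; x∈⁅y⁆⇒x≡y; ∣⁅x⁆∣≡1; Empty-unique; ⊆-antisym; ⊆-reflexive
        ; p⊆q⇒∣p∣≤∣q∣; ∣q∣≤∣p∪q∣; p∩q⊆p; p∩q⊆q; x∈p∩q⁺; x∈p∩q⁻; x∈p∪q⁺; x∈p∪q⁻; ∩-distribʳ-∪; ∩-identityʳ
        ; x∈p∧x∉q⇒x∈p─q; x∈p∧x≢y⇒x∈p-y; p─q⊆p; x∈p⇒∣p-x∣<∣p∣; _∈?_; _⊆?_; anySubset? )
open import Data.Vec using ([]; _∷_; here; there; lookup; tabulate)
open import Data.Vec.Properties using (lookup∘tabulate; []=⇒lookup; lookup⇒[]=)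
open import Data.Product using (Σ; ∃; _×_; _,_; proj₁)
open import Data.Sum using (_⊎_; inj₁; inj₂; [_,_]; map)
open import Function using (const; _∘_)
open import Induction.WellFounded using (Acc; acc)
open import Relation.Nullary using (¬_; Dec; yes; no; ¬?; contradiction)
open import Relation.Nullary.Decidable using (_×-dec_)
open import Relation.Binary.PropositionalEquality using (_≡_; _≢_; refl; sym; trans; cong; cong₂; subst; subst₂)

private
  variable
    k m n : ℕ

-- Cardinality

∣p∪q∣+∣p∩q∣≡∣p∣+∣q∣ : (p q : Subset n) → ∣ p ∪ q ∣ + ∣ p ∩ q ∣ ≡ ∣ p ∣ + ∣ q ∣
∣p∪q∣+∣p∩q∣≡∣p∣+∣q∣ [] [] = refl
∣p∪q∣+∣p∩q∣≡∣p∣+∣q∣ (inside ∷ p) (inside ∷ q) =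
  cong suc (trans (ℕ.+-suc _ _) (trans (cong suc (∣p∪q∣+∣p∩q∣≡∣p∣+∣q∣ p q)) (sym (ℕ.+-suc _ _))))
∣p∪q∣+∣p∩q∣≡∣p∣+∣q∣ (inside ∷ p) (outside ∷ q) = cong suc (∣p∪q∣+∣p∩q∣≡∣p∣+∣q∣ p q)
∣p∪q∣+∣p∩q∣≡∣p∣+∣q∣ (outside ∷ p) (inside ∷ q) =
  trans (cong suc (∣p∪q∣+∣p∩q∣≡∣p∣+∣q∣ p q)) (sym (ℕ.+-suc _ _))
∣p∪q∣+∣p∩q∣≡∣p∣+∣q∣ (outside ∷ p) (outside ∷ q) = ∣p∪q∣+∣p∩q∣≡∣p∣+∣q∣ p q

∣p∪q∣≤∣p∣+∣q∣ : (p q : Subset n) → ∣ p ∪ q ∣ ≤ ∣ p ∣ + ∣ q ∣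
∣p∪q∣≤∣p∣+∣q∣ p q = subst (∣ p ∪ q ∣ ≤_) (∣p∪q∣+∣p∩q∣≡∣p∣+∣q∣ p q) (ℕ.m≤m+n _ _)

Empty⇒∣p∣≡0 : {p : Subset n} → Empty p → ∣ p ∣ ≡ 0
Empty⇒∣p∣≡0 {n} empty = trans (cong ∣_∣ (Empty-unique empty)) (∣⊥∣≡0 n)

∣p∣+∣q∣≤∣p∪q∣ : (p q : Subset n) → Empty (p ∩ q) → ∣ p ∣ + ∣ q ∣ ≤ ∣ p ∪ q ∣
∣p∣+∣q∣≤∣p∪q∣ p q disjoint = begin
  ∣ p ∣ + ∣ q ∣              ≡⟨ sym (∣p∪q∣+∣p∩q∣≡∣p∣+∣q∣ p q) ⟩
  ∣ p ∪ q ∣ + ∣ p ∩ q ∣      ≡⟨ cong (∣ p ∪ q ∣ +_) (Empty⇒∣p∣≡0 disjoint) ⟩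
  ∣ p ∪ q ∣ + 0              ≡⟨ ℕ.+-identityʳ _ ⟩
  ∣ p ∪ q ∣                  ∎
  where open ℕ.≤-Reasoning

∣p∣≤1+∣p-x∣ : (p : Subset n) (x : Fin n) → ∣ p ∣ ≤ suc ∣ p - x ∣
∣p∣≤1+∣p-x∣ p x = begin
  ∣ p ∣                    ≤⟨ p⊆q⇒∣p∣≤∣q∣ p⊆x∪p-x ⟩
  ∣ ⁅ x ⁆ ∪ (p - x) ∣      ≤⟨ ∣p∪q∣≤∣p∣+∣q∣ ⁅ x ⁆ (p - x) ⟩
  ∣ ⁅ x ⁆ ∣ + ∣ p - x ∣    ≡⟨ cong (_+ ∣ p - x ∣) (∣⁅x⁆∣≡1 x) ⟩
  suc ∣ p - x ∣            ∎
  where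
  open ℕ.≤-Reasoning
  p⊆x∪p-x : p ⊆ ⁅ x ⁆ ∪ (p - x)
  p⊆x∪p-x {z} z∈p with z ≟ x
  ... | yes refl = x∈p∪q⁺ (inj₁ (x∈⁅x⁆ x))
  ... | no z≢x   = x∈p∪q⁺ (inj₂ (x∈p∧x≢y⇒x∈p-y z∈p z≢x))

x∈p─q⇒x∉q : {p q : Subset n} {x : Fin n} → x ∈ p ─ q → x ∉ q
x∈p─q⇒x∉q {p = inside ∷ p} {outside ∷ q} here ()
x∈p─q⇒x∉q {p = _ ∷ p} {_ ∷ q} (there x∈) (there x∈q) = x∈p─q⇒x∉q x∈ x∈q

-- Images and preimages

∈image⁺ : (π : Fin m → Fin n) {Y : Subset m} {y : Fin m} → y ∈ Y → π y ∈ image π Y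
∈image⁺ π {inside ∷ Y} here = x∈p∪q⁺ (inj₁ (x∈⁅x⁆ (π zero)))
∈image⁺ π {b ∷ Y} (there y∈Y) = x∈p∪q⁺ (inj₂ (∈image⁺ (λ y → π (suc y)) y∈Y))

∈image⁻ : (π : Fin m → Fin n) {Y : Subset m} {i : Fin n} → i ∈ image π Y → ∃ λ y → y ∈ Y × π y ≡ i
∈image⁻ π {[]} i∈ = contradiction i∈ ∉⊥
∈image⁻ π {inside ∷ Y} i∈ with x∈p∪q⁻ ⁅ π zero ⁆ (image (λ y → π (suc y)) Y) i∈
... | inj₁ i∈⁅π0⁆ = zero , here , sym (x∈⁅y⁆⇒x≡y (π zero) i∈⁅π0⁆)
... | inj₂ i∈rest = let y , y∈Y , πy≡i = ∈image⁻ (λ y → π (suc y)) i∈rest in suc y , there y∈Y , πy≡i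
∈image⁻ π {outside ∷ Y} i∈ with x∈p∪q⁻ ⊥ (image (λ y → π (suc y)) Y) i∈
... | inj₁ i∈⊥ = contradiction i∈⊥ ∉⊥
... | inj₂ i∈rest = let y , y∈Y , πy≡i = ∈image⁻ (λ y → π (suc y)) i∈rest in suc y , there y∈Y , πy≡i

image⊆ : (π : Fin m → Fin n) {Y : Subset m} {A : Subset n} → (∀ {y} → y ∈ Y → π y ∈ A) → image π Y ⊆ A
image⊆ π πY⊆A i∈ = let y , y∈Y , πy≡i = ∈image⁻ π i∈ in subst (_∈ _) πy≡i (πY⊆A y∈Y)

image-mono : (π : Fin m → Fin n) {X Y : Subset m} → X ⊆ Y → image π X ⊆ image π Y
image-mono π X⊆Y = image⊆ π (λ y∈X → ∈image⁺ π (X⊆Y y∈X))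

image-∪ : (π : Fin m → Fin n) (X Y : Subset m) → image π (X ∪ Y) ⊆ image π X ∪ image π Y
image-∪ π X Y = image⊆ π λ y∈X∪Y → x∈p∪q⁺ (map (∈image⁺ π) (∈image⁺ π) (x∈p∪q⁻ X Y y∈X∪Y))

image-∩ : (π : Fin m → Fin n) (X Y : Subset m) → image π (X ∩ Y) ⊆ image π X ∩ image π Y
image-∩ π X Y = image⊆ π λ y∈X∩Y →
  let y∈X , y∈Y = x∈p∩q⁻ X Y y∈X∩Y in x∈p∩q⁺ (∈image⁺ π y∈X , ∈image⁺ π y∈Y)

∣image∣≤∣∣ : (π : Fin m → Fin n) (Y : Subset m) → ∣ image π Y ∣ ≤ ∣ Y ∣
∣image∣≤∣∣ {n = n} π [] = ≤-reflexive (∣⊥∣≡0 n)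
∣image∣≤∣∣ π (inside ∷ Y) = begin
  ∣ ⁅ π zero ⁆ ∪ image π′ Y ∣          ≤⟨ ∣p∪q∣≤∣p∣+∣q∣ ⁅ π zero ⁆ (image π′ Y) ⟩
  ∣ ⁅ π zero ⁆ ∣ + ∣ image π′ Y ∣      ≡⟨ cong (_+ ∣ image π′ Y ∣) (∣⁅x⁆∣≡1 (π zero)) ⟩
  suc ∣ image π′ Y ∣                   ≤⟨ s≤s (∣image∣≤∣∣ π′ Y) ⟩
  suc ∣ Y ∣                            ∎
  where
  open ℕ.≤-Reasoning
  π′ = λ y → π (suc y)
∣image∣≤∣∣ {n = n} π (outside ∷ Y) = begin
  ∣ ⊥ ∪ image π′ Y ∣        ≤⟨ ∣p∪q∣≤∣p∣+∣q∣ ⊥ (image π′ Y) ⟩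
  ∣ ⊥ {n} ∣ + ∣ image π′ Y ∣ ≡⟨ cong (_+ ∣ image π′ Y ∣) (∣⊥∣≡0 n) ⟩
  ∣ image π′ Y ∣            ≤⟨ ∣image∣≤∣∣ π′ Y ⟩
  ∣ Y ∣                     ∎
  where
  open ℕ.≤-Reasoning
  π′ = λ y → π (suc y)

∣∣≤∣image∣ : (π : Fin m → Fin n) (Y : Subset m) → InjectiveOn π Y → ∣ Y ∣ ≤ ∣ image π Y ∣
∣∣≤∣image∣ π [] _ = z≤n
∣∣≤∣image∣ π (outside ∷ Y) injective = begin
  ∣ Y ∣                ≤⟨ ∣∣≤∣image∣ π′ Y (λ x y x∈ y∈ eq → suc-injective (injective _ _ (there x∈) (there y∈) eq)) ⟩
  ∣ image π′ Y ∣       ≤⟨ ∣q∣≤∣p∪q∣ ⊥ (image π′ Y) ⟩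
  ∣ ⊥ ∪ image π′ Y ∣   ∎
  where
  open ℕ.≤-Reasoning
  π′ = λ y → π (suc y)
∣∣≤∣image∣ π (inside ∷ Y) injective = begin
  suc ∣ Y ∣                          ≤⟨ s≤s (∣∣≤∣image∣ π′ Y (λ x y x∈ y∈ eq → suc-injective (injective _ _ (there x∈) (there y∈) eq))) ⟩
  suc ∣ image π′ Y ∣                 ≡⟨ cong (_+ ∣ image π′ Y ∣) (∣⁅x⁆∣≡1 (π zero)) ⟨
  ∣ ⁅ π zero ⁆ ∣ + ∣ image π′ Y ∣    ≤⟨ ∣p∣+∣q∣≤∣p∪q∣ ⁅ π zero ⁆ (image π′ Y) disjoint ⟩
  ∣ ⁅ π zero ⁆ ∪ image π′ Y ∣        ∎
  where
  open ℕ.≤-Reasoning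
  π′ = λ y → π (suc y)
  disjoint : Empty (⁅ π zero ⁆ ∩ image π′ Y)
  disjoint (i , i∈) with x∈p∩q⁻ ⁅ π zero ⁆ (image π′ Y) i∈
  ... | i∈⁅π0⁆ , i∈rest with ∈image⁻ π′ i∈rest
  ...   | y , y∈Y , πy≡i with injective (suc y) zero (there y∈Y) here (trans πy≡i (x∈⁅y⁆⇒x≡y (π zero) i∈⁅π0⁆))
  ...     | ()

∈preimage⁺ : (π : Fin m → Fin n) {A : Subset n} {y : Fin m} → π y ∈ A → y ∈ preimage π A
∈preimage⁺ π {A} {y} πy∈A =
  lookup⇒[]= y (preimage π A) (trans (lookup∘tabulate (λ y → lookup A (π y)) y) ([]=⇒lookup πy∈A))

∈preimage⁻ : (π : Fin m → Fin n) {A : Subset n} {y : Fin m} → y ∈ preimage π A → π y ∈ A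
∈preimage⁻ π {A} {y} y∈ =
  lookup⇒[]= (π y) A (trans (sym (lookup∘tabulate (λ y → lookup A (π y)) y)) ([]=⇒lookup y∈))

image-preimage⊆ : (π : Fin m → Fin n) (A : Subset n) → image π (preimage π A) ⊆ A
image-preimage⊆ π A = image⊆ π (∈preimage⁻ π)

⊆preimage-image : (π : Fin m → Fin n) (Y : Subset m) → Y ⊆ preimage π (image π Y)
⊆preimage-image π Y y∈Y = ∈preimage⁺ π (∈image⁺ π y∈Y)

-- Sums over Fin k

sumFin-mono : (f g : Fin k → ℕ) → (∀ j → f j ≤ g j) → sumFin k f ≤ sumFin k g
sumFin-mono {zero} f g f≤g = z≤n
sumFin-mono {suc k} f g f≤g = +-mono-≤ (f≤g zero) (sumFin-mono (λ j → f (suc j)) (λ j → g (suc j)) (λ j → f≤g (suc j)))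

sumFin-mono-< : (f g : Fin k → ℕ) → (∀ j → f j ≤ g j) → ∀ j → f j < g j → sumFin k f < sumFin k g
sumFin-mono-< {suc k} f g f≤g zero f0<g0 =
  ℕ.+-mono-<-≤ f0<g0 (sumFin-mono (λ j → f (suc j)) (λ j → g (suc j)) (λ j → f≤g (suc j)))
sumFin-mono-< {suc k} f g f≤g (suc j) fj<gj =
  ℕ.+-mono-≤-< (f≤g zero) (sumFin-mono-< (λ j → f (suc j)) (λ j → g (suc j)) (λ j → f≤g (suc j)) j fj<gj)

sumFin-+ : (f g : Fin k → ℕ) → sumFin k (λ j → f j + g j) ≡ sumFin k f + sumFin k g
sumFin-+ {zero} f g = refl
sumFin-+ {suc k} f g =
  trans (cong (f zero + g zero +_) (sumFin-+ (λ j → f (suc j)) (λ j → g (suc j))))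
        (interchange (f zero) (g zero) (sumFin k (λ j → f (suc j))) (sumFin k (λ j → g (suc j))))

sumFin-zero : (f : Fin k → ℕ) → (∀ j → f j ≡ 0) → sumFin k f ≡ 0
sumFin-zero {zero} f f≡0 = refl
sumFin-zero {suc k} f f≡0 = cong₂ _+_ (f≡0 zero) (sumFin-zero (λ j → f (suc j)) (λ j → f≡0 (suc j)))

sumFin-single : (f : Fin k → ℕ) (j : Fin k) → (∀ i → i ≢ j → f i ≡ 0) → sumFin k f ≡ f j
sumFin-single {suc k} f zero others≡0 =
  trans (cong (f zero +_) (sumFin-zero (λ i → f (suc i)) (λ i → others≡0 (suc i) λ ()))) (ℕ.+-identityʳ (f zero))
sumFin-single {suc k} f (suc j) others≡0 =
  cong₂ _+_ (others≡0 zero λ ()) (sumFin-single (λ i → f (suc i)) j (λ i i≢j → others≡0 (suc i) (i≢j ∘ suc-injective)))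

unionFin-∩-≤ : (J : Fin k → Subset m) (P : Subset m) → ∣ unionFin k J ∩ P ∣ ≤ sumFin k (λ j → ∣ J j ∩ P ∣)
unionFin-∩-≤ {zero} J P = ≤-reflexive (Empty⇒∣p∣≡0 λ (z , z∈) → ∉⊥ (proj₁ (x∈p∩q⁻ ⊥ P z∈)))
unionFin-∩-≤ {suc k} J P = begin
  ∣ (J zero ∪ R) ∩ P ∣              ≡⟨ cong ∣_∣ (∩-distribʳ-∪ P (J zero) R) ⟩
  ∣ (J zero ∩ P) ∪ (R ∩ P) ∣        ≤⟨ ∣p∪q∣≤∣p∣+∣q∣ (J zero ∩ P) (R ∩ P) ⟩
  ∣ J zero ∩ P ∣ + ∣ R ∩ P ∣        ≤⟨ +-mono-≤ ≤-refl (unionFin-∩-≤ (λ j → J (suc j)) P) ⟩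
  sumFin (suc k) (λ j → ∣ J j ∩ P ∣) ∎
  where
  open ℕ.≤-Reasoning
  R = unionFin k (λ j → J (suc j))

∈unionFin⁺ : (J : Fin k → Subset m) {x : Fin m} (j : Fin k) → x ∈ J j → x ∈ unionFin k J
∈unionFin⁺ {suc k} J zero x∈J0 = x∈p∪q⁺ (inj₁ x∈J0)
∈unionFin⁺ {suc k} J (suc j) x∈Jj = x∈p∪q⁺ (inj₂ (∈unionFin⁺ (λ j → J (suc j)) j x∈Jj))

∈unionFin⁻ : (J : Fin k → Subset m) {x : Fin m} → x ∈ unionFin k J → ∃ λ j → x ∈ J j
∈unionFin⁻ {zero} J x∈ = contradiction x∈ ∉⊥
∈unionFin⁻ {suc k} J x∈ with x∈p∪q⁻ (J zero) (unionFin k (λ j → J (suc j))) x∈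
... | inj₁ x∈J0 = zero , x∈J0
... | inj₂ x∈rest = let j , x∈Jj = ∈unionFin⁻ (λ j → J (suc j)) x∈rest in suc j , x∈Jj

-- Matroids

rank-empty : (M : Matroid n) {X : Subset n} → Empty X → rank M X ≡ 0
rank-empty M {X} empty = ℕ.n≤0⇒n≡0 (subst (rank M X ≤_) (Empty⇒∣p∣≡0 empty) (rank-bound M X))

rank-∪-≤ : (M : Matroid n) (X Y : Subset n) → rank M (X ∪ Y) ≤ rank M X + ∣ Y ∣
rank-∪-≤ M X Y = begin
  rank M (X ∪ Y)                        ≤⟨ ℕ.m≤m+n _ _ ⟩
  rank M (X ∪ Y) + rank M (X ∩ Y)       ≤⟨ rank-submod M X Y ⟩
  rank M X + rank M Y                   ≤⟨ +-mono-≤ ≤-refl (rank-bound M Y) ⟩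
  rank M X + ∣ Y ∣                      ∎
  where open ℕ.≤-Reasoning

indep-⊆ : (M : Matroid n) {X Y : Subset n} → Indep M X → Y ⊆ X → Indep M Y
indep-⊆ M {X} {Y} indepX Y⊆X = ≤-antisym (rank-bound M Y) (ℕ.+-cancelʳ-≤ ∣ Z ∣ ∣ Y ∣ (rank M Y) (begin
  ∣ Y ∣ + ∣ Z ∣          ≤⟨ ∣p∣+∣q∣≤∣p∪q∣ Y Z disjoint ⟩
  ∣ Y ∪ Z ∣              ≤⟨ p⊆q⇒∣p∣≤∣q∣ Y∪Z⊆X ⟩
  ∣ X ∣                  ≡⟨ indepX ⟨
  rank M X               ≤⟨ rank-mono M X (Y ∪ Z) X⊆Y∪Z ⟩
  rank M (Y ∪ Z)         ≤⟨ rank-∪-≤ M Y Z ⟩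
  rank M Y + ∣ Z ∣       ∎))
  where
  open ℕ.≤-Reasoning
  Z = X ─ Y
  disjoint : Empty (Y ∩ Z)
  disjoint (z , z∈) = let z∈Y , z∈Z = x∈p∩q⁻ Y Z z∈ in x∈p─q⇒x∉q z∈Z z∈Y
  Y∪Z⊆X : Y ∪ Z ⊆ X
  Y∪Z⊆X z∈ = [ Y⊆X , p─q⊆p X Y ] (x∈p∪q⁻ Y Z z∈)
  X⊆Y∪Z : X ⊆ Y ∪ Z
  X⊆Y∪Z {z} z∈X with z ∈? Y
  ... | yes z∈Y = x∈p∪q⁺ (inj₁ z∈Y)
  ... | no z∉Y  = x∈p∪q⁺ (inj₂ (x∈p∧x∉q⇒x∈p─q z∈X z∉Y))

-- The matroid M' of the statement: replacing i by the parallel class X_i makes the rank of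
-- Y ⊆ E' the rank of π Y.
parallelExtension : Matroid n → (Fin m → Fin n) → Matroid m
parallelExtension M π = record
  { rank        = λ Y → rank M (image π Y)
  ; rank-bound  = λ Y → ≤-trans (rank-bound M (image π Y)) (∣image∣≤∣∣ π Y)
  ; rank-mono   = λ X Y X⊆Y → rank-mono M _ _ (image-mono π X⊆Y)
  ; rank-submod = λ X Y → ≤-trans (+-mono-≤ (rank-mono M _ _ (image-∪ π X Y)) (rank-mono M _ _ (image-∩ π X Y)))
                                  (rank-submod M (image π X) (image π Y))
  }

-- Two distinct elements with the same image would form a subset of J larger than its image.
injectiveOn-if-∣∣≤∣image∣ : (π : Fin m → Fin n) (J : Subset m) →
  (∀ Y → Y ⊆ J → ∣ Y ∣ ≤ ∣ image π Y ∣) → InjectiveOn π J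
injectiveOn-if-∣∣≤∣image∣ π J card≤ x y x∈J y∈J πx≡πy with x ≟ y
... | yes x≡y = x≡y
... | no x≢y = contradiction (card≤ pair pair⊆J) (ℕ.<⇒≱ (begin-strict
  ∣ image π pair ∣         ≤⟨ p⊆q⇒∣p∣≤∣q∣ (image⊆ π image⊆⁅πx⁆) ⟩
  ∣ ⁅ π x ⁆ ∣              ≡⟨ ∣⁅x⁆∣≡1 (π x) ⟩
  1                        <⟨ s≤s (s≤s z≤n) ⟩
  2                        ≡⟨ cong₂ _+_ (∣⁅x⁆∣≡1 x) (∣⁅x⁆∣≡1 y) ⟨
  ∣ ⁅ x ⁆ ∣ + ∣ ⁅ y ⁆ ∣    ≤⟨ ∣p∣+∣q∣≤∣p∪q∣ ⁅ x ⁆ ⁅ y ⁆ disjoint ⟩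
  ∣ pair ∣                 ∎))
  where
  open ℕ.≤-Reasoning
  pair = ⁅ x ⁆ ∪ ⁅ y ⁆
  pair⊆J : pair ⊆ J
  pair⊆J z∈ with x∈p∪q⁻ ⁅ x ⁆ ⁅ y ⁆ z∈
  ... | inj₁ z∈⁅x⁆ = subst (_∈ J) (sym (x∈⁅y⁆⇒x≡y x z∈⁅x⁆)) x∈J
  ... | inj₂ z∈⁅y⁆ = subst (_∈ J) (sym (x∈⁅y⁆⇒x≡y y z∈⁅y⁆)) y∈J
  image⊆⁅πx⁆ : ∀ {z} → z ∈ pair → π z ∈ ⁅ π x ⁆
  image⊆⁅πx⁆ z∈ with x∈p∪q⁻ ⁅ x ⁆ ⁅ y ⁆ z∈
  ... | inj₁ z∈⁅x⁆ = subst (λ w → π w ∈ ⁅ π x ⁆) (sym (x∈⁅y⁆⇒x≡y x z∈⁅x⁆)) (x∈⁅x⁆ (π x))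
  ... | inj₂ z∈⁅y⁆ = subst (λ w → π w ∈ ⁅ π x ⁆) (sym (x∈⁅y⁆⇒x≡y y z∈⁅y⁆)) (subst (_∈ ⁅ π x ⁆) πx≡πy (x∈⁅x⁆ (π x)))
  disjoint : Empty (⁅ x ⁆ ∩ ⁅ y ⁆)
  disjoint (z , z∈) = let z∈⁅x⁆ , z∈⁅y⁆ = x∈p∩q⁻ ⁅ x ⁆ ⁅ y ⁆ z∈ in
    x≢y (trans (sym (x∈⁅y⁆⇒x≡y x z∈⁅x⁆)) (x∈⁅y⁆⇒x≡y y z∈⁅y⁆))

indepParallel⇒indep : (M : Matroid n) (π : Fin m → Fin n) {J : Subset m} →
  IndepParallel M π J → Indep (parallelExtension M π) J
indepParallel⇒indep M π {J} (injective , indepπJ) =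
  trans indepπJ (≤-antisym (∣image∣≤∣∣ π J) (∣∣≤∣image∣ π J injective))

indep⇒indepParallel : (M : Matroid n) (π : Fin m → Fin n) {J : Subset m} →
  Indep (parallelExtension M π) J → IndepParallel M π J
indep⇒indepParallel M π {J} indepJ = injective , indepπJ
  where
  injective : InjectiveOn π J
  injective = injectiveOn-if-∣∣≤∣image∣ π J λ Y Y⊆J →
    subst (_≤ ∣ image π Y ∣) (indep-⊆ (parallelExtension M π) indepJ Y⊆J) (rank-bound M (image π Y))
  indepπJ : Indep M (image π J)
  indepπJ = ≤-antisym (rank-bound M (image π J)) (≤-trans (∣image∣≤∣∣ π J) (≤-reflexive (sym indepJ)))

-- Rado's theorem

∣unionFin∩∣≤sum-rank : (N : Fin k → Matroid m) (J : Fin k → Subset m) → (∀ j → Indep (N j) (J j)) →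
  ∀ P → ∣ unionFin k J ∩ P ∣ ≤ sumFin k (λ j → rank (N j) P)
∣unionFin∩∣≤sum-rank N J indepJ P = ≤-trans (unionFin-∩-≤ J P) (sumFin-mono _ _ λ j → begin
  ∣ J j ∩ P ∣            ≡⟨ indep-⊆ (N j) (indepJ j) (p∩q⊆p (J j) P) ⟨
  rank (N j) (J j ∩ P)   ≤⟨ rank-mono (N j) _ _ (p∩q⊆q (J j) P) ⟩
  rank (N j) P           ∎)
  where open ℕ.≤-Reasoning

-- Welsh's proof: element x ∈ I may be put into the j-th set only if x ∈ C j.  Starting from
-- C j = ⊤, we remove elements from colour classes one at a time while keeping Hall's condition,
-- until every element of I has a single colour.
module Rado (N : Fin k → Matroid m) (I : Subset m) where

  Colouring : Set
  Colouring = Fin k → Subset m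

  colourRank : Colouring → Subset m → Fin k → ℕ
  colourRank C P j = rank (N j) (P ∩ C j)

  colouredRank : Colouring → Subset m → ℕ
  colouredRank C P = sumFin k (colourRank C P)

  Hall : Colouring → Set
  Hall C = ∀ P → P ⊆ I → ∣ P ∣ ≤ colouredRank C P

  hall? : (C : Colouring) → Hall C ⊎ ∃ λ P → P ⊆ I × colouredRank C P < ∣ P ∣
  hall? C with anySubset? (λ P → (P ⊆? I) ×-dec (suc (colouredRank C P) ≤? ∣ P ∣))
  ... | yes violator = inj₂ violator
  ... | no ¬violator = inj₁ λ P P⊆I → ℕ.≮⇒≥ λ lt → ¬violator (P , P⊆I , lt)

  record Split (C C₁ C₂ : Colouring) (x : Fin m) : Set where
    field
      agree₁ : ∀ j {z} → z ∈ C j → z ≢ x → z ∈ C₁ j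
      agree₂ : ∀ j {z} → z ∈ C j → z ≢ x → z ∈ C₂ j
      keep   : ∀ j → x ∈ C j → x ∈ C₁ j ⊎ x ∈ C₂ j

  colouredRank-agree : (C C′ : Colouring) {x : Fin m} → (∀ j {z} → z ∈ C j → z ≢ x → z ∈ C′ j) →
    ∀ {P} → x ∉ P → colouredRank C P ≤ colouredRank C′ P
  colouredRank-agree C C′ {x} agree {P} x∉P = sumFin-mono _ _ λ j → rank-mono (N j) _ _ λ z∈ →
    let z∈P , z∈Cj = x∈p∩q⁻ P (C j) z∈ in
    x∈p∩q⁺ (z∈P , agree j z∈Cj λ { refl → x∉P z∈P })

  split-submodular : (C C₁ C₂ : Colouring) {x : Fin m} → Split C C₁ C₂ x →
    ∀ {P₁ P₂} → x ∈ P₁ → x ∈ P₂ → ∀ j →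
    colourRank C (P₁ ∪ P₂) j + colourRank C ((P₁ ∩ P₂) - x) j ≤ colourRank C₁ P₁ j + colourRank C₂ P₂ j
  split-submodular C C₁ C₂ {x} split {P₁} {P₂} x∈P₁ x∈P₂ j =
    ≤-trans (+-mono-≤ (rank-mono (N j) _ _ U∩C⊆) (rank-mono (N j) _ _ Q∩C⊆)) (rank-submod (N j) (P₁ ∩ C₁ j) (P₂ ∩ C₂ j))
    where
    open Split split
    U∩C⊆ : (P₁ ∪ P₂) ∩ C j ⊆ (P₁ ∩ C₁ j) ∪ (P₂ ∩ C₂ j)
    U∩C⊆ {z} z∈ with x∈p∩q⁻ (P₁ ∪ P₂) (C j) z∈ | z ≟ x
    ... | _ , x∈Cj | yes refl =
      x∈p∪q⁺ (map (λ x∈C₁ → x∈p∩q⁺ (x∈P₁ , x∈C₁)) (λ x∈C₂ → x∈p∩q⁺ (x∈P₂ , x∈C₂)) (keep j x∈Cj))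
    ... | z∈U , z∈Cj | no z≢x =
      x∈p∪q⁺ (map (λ z∈P₁ → x∈p∩q⁺ (z∈P₁ , agree₁ j z∈Cj z≢x)) (λ z∈P₂ → x∈p∩q⁺ (z∈P₂ , agree₂ j z∈Cj z≢x))
                  (x∈p∪q⁻ P₁ P₂ z∈U))
    Q∩C⊆ : ((P₁ ∩ P₂) - x) ∩ C j ⊆ (P₁ ∩ C₁ j) ∩ (P₂ ∩ C₂ j)
    Q∩C⊆ {z} z∈ =
      let z∈Q , z∈Cj = x∈p∩q⁻ ((P₁ ∩ P₂) - x) (C j) z∈
          z∈P₁ , z∈P₂ = x∈p∩q⁻ P₁ P₂ (p─q⊆p (P₁ ∩ P₂) ⁅ x ⁆ z∈Q)
          z≢x = λ z≡x → x∈p─q⇒x∉q z∈Q (subst (_∈ ⁅ x ⁆) (sym z≡x) (x∈⁅x⁆ x))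
      in x∈p∩q⁺ (x∈p∩q⁺ (z∈P₁ , agree₁ j z∈Cj z≢x) , x∈p∩q⁺ (z∈P₂ , agree₂ j z∈Cj z≢x))

  -- Removing x from P₁ ∩ P₂ costs at most one element, which is the "suc" on the right.
  welsh-inequality : (C C₁ C₂ : Colouring) {x : Fin m} → Split C C₁ C₂ x → Hall C →
    ∀ {P₁ P₂} → P₁ ⊆ I → P₂ ⊆ I → x ∈ P₁ → x ∈ P₂ →
    ∣ P₁ ∣ + ∣ P₂ ∣ ≤ suc (colouredRank C₁ P₁ + colouredRank C₂ P₂)
  welsh-inequality C C₁ C₂ {x} split hall {P₁} {P₂} P₁⊆I P₂⊆I x∈P₁ x∈P₂ = begin
    ∣ P₁ ∣ + ∣ P₂ ∣                                 ≡⟨ ∣p∪q∣+∣p∩q∣≡∣p∣+∣q∣ P₁ P₂ ⟨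
    ∣ U ∣ + ∣ P₁ ∩ P₂ ∣                             ≤⟨ +-mono-≤ ≤-refl (∣p∣≤1+∣p-x∣ (P₁ ∩ P₂) x) ⟩
    ∣ U ∣ + suc ∣ Q ∣                               ≡⟨ ℕ.+-suc ∣ U ∣ ∣ Q ∣ ⟩
    suc (∣ U ∣ + ∣ Q ∣)                             ≤⟨ s≤s (+-mono-≤ (hall U U⊆I) (hall Q Q⊆I)) ⟩
    suc (colouredRank C U + colouredRank C Q)       ≡⟨ cong suc (sumFin-+ (colourRank C U) (colourRank C Q)) ⟨
    suc (sumFin k (λ j → colourRank C U j + colourRank C Q j))
                                                    ≤⟨ s≤s (sumFin-mono _ _ (split-submodular C C₁ C₂ split x∈P₁ x∈P₂)) ⟩
    suc (sumFin k (λ j → colourRank C₁ P₁ j + colourRank C₂ P₂ j))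
                                                    ≡⟨ cong suc (sumFin-+ (colourRank C₁ P₁) (colourRank C₂ P₂)) ⟩
    suc (colouredRank C₁ P₁ + colouredRank C₂ P₂)   ∎
    where
    open ℕ.≤-Reasoning
    U = P₁ ∪ P₂
    Q = (P₁ ∩ P₂) - x
    U⊆I : U ⊆ I
    U⊆I z∈ = [ P₁⊆I , P₂⊆I ] (x∈p∪q⁻ P₁ P₂ z∈)
    Q⊆I : Q ⊆ I
    Q⊆I z∈ = P₁⊆I (p∩q⊆p P₁ P₂ (p─q⊆p (P₁ ∩ P₂) ⁅ x ⁆ z∈))

  -- A violator P₁ for C₁ must contain x, and then Welsh's inequality leaves no room for one for C₂.
  hall-split : (C C₁ C₂ : Colouring) {x : Fin m} → Split C C₁ C₂ x → Hall C → Hall C₁ ⊎ Hall C₂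
  hall-split C C₁ C₂ {x} split hall with hall? C₁
  ... | inj₁ hall₁ = inj₁ hall₁
  ... | inj₂ (P₁ , P₁⊆I , violates) = inj₂ hall₂
    where
    open Split split
    x∈P₁ : x ∈ P₁
    x∈P₁ with x ∈? P₁
    ... | yes x∈ = x∈
    ... | no x∉ = contradiction (≤-trans (hall P₁ P₁⊆I) (colouredRank-agree C C₁ agree₁ x∉)) (ℕ.<⇒≱ violates)
    hall₂ : Hall C₂
    hall₂ P₂ P₂⊆I with x ∈? P₂
    ... | no x∉ = ≤-trans (hall P₂ P₂⊆I) (colouredRank-agree C C₂ agree₂ x∉)
    ... | yes x∈P₂ = ℕ.+-cancelˡ-≤ (suc (colouredRank C₁ P₁)) _ _
      (≤-trans (+-mono-≤ violates ≤-refl) (welsh-inequality C C₁ C₂ split hall P₁⊆I P₂⊆I x∈P₁ x∈P₂))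

  uncolour : Colouring → Fin k → Fin m → Colouring
  uncolour C j₀ x j with j ≟ j₀
  ... | yes _ = C j - x
  ... | no _  = C j

  uncolour-agree : (C : Colouring) (j₀ : Fin k) (x : Fin m) → ∀ j {z} → z ∈ C j → z ≢ x → z ∈ uncolour C j₀ x j
  uncolour-agree C j₀ x j z∈Cj z≢x with j ≟ j₀
  ... | yes _ = x∈p∧x≢y⇒x∈p-y z∈Cj z≢x
  ... | no _  = z∈Cj

  uncolour-split : (C : Colouring) {j₁ j₂ : Fin k} (x : Fin m) → j₁ ≢ j₂ → Split C (uncolour C j₁ x) (uncolour C j₂ x) x
  uncolour-split C {j₁} {j₂} x j₁≢j₂ = record
    { agree₁ = uncolour-agree C j₁ x
    ; agree₂ = uncolour-agree C j₂ x
    ; keep   = keep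
    }
    where
    keep : ∀ j → x ∈ C j → x ∈ uncolour C j₁ x j ⊎ x ∈ uncolour C j₂ x j
    keep j x∈Cj with j ≟ j₁ | j ≟ j₂
    ... | no _     | _        = inj₁ x∈Cj
    ... | yes _    | no _     = inj₂ x∈Cj
    ... | yes j≡j₁ | yes j≡j₂ = contradiction (trans (sym j≡j₁) j≡j₂) j₁≢j₂

  weight : Colouring → ℕ
  weight C = sumFin k (λ j → ∣ C j ∣)

  weight-uncolour : (C : Colouring) {j₀ : Fin k} {x : Fin m} → x ∈ C j₀ → weight (uncolour C j₀ x) < weight C
  weight-uncolour C {j₀} {x} x∈Cj₀ = sumFin-mono-< _ _ shrinks j₀ strict
    where
    shrinks : ∀ j → ∣ uncolour C j₀ x j ∣ ≤ ∣ C j ∣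
    shrinks j with j ≟ j₀
    ... | yes _ = p⊆q⇒∣p∣≤∣q∣ (p─q⊆p (C j) ⁅ x ⁆)
    ... | no _  = ≤-refl
    strict : ∣ uncolour C j₀ x j₀ ∣ < ∣ C j₀ ∣
    strict with j₀ ≟ j₀
    ... | yes _    = x∈p⇒∣p-x∣<∣p∣ x∈Cj₀
    ... | no j₀≢j₀ = contradiction refl j₀≢j₀

  Unambiguous : Colouring → Set
  Unambiguous C = ∀ {x i j} → x ∈ I → x ∈ C i → x ∈ C j → i ≡ j

  Ambiguity : Colouring → Set
  Ambiguity C = ∃ λ x → x ∈ I × ∃ λ i → ∃ λ j → i ≢ j × x ∈ C i × x ∈ C j

  ambiguity? : (C : Colouring) → Dec (Ambiguity C)
  ambiguity? C = any? λ x → (x ∈? I) ×-dec any? λ i → any? λ j → ¬? (i ≟ j) ×-dec (x ∈? C i) ×-dec (x ∈? C j)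

  ¬ambiguity⇒unambiguous : (C : Colouring) → ¬ Ambiguity C → Unambiguous C
  ¬ambiguity⇒unambiguous C ¬ambiguity {x} {i} {j} x∈I x∈Ci x∈Cj with i ≟ j
  ... | yes i≡j = i≡j
  ... | no i≢j  = contradiction (x , x∈I , i , j , i≢j , x∈Ci , x∈Cj) ¬ambiguity

  unambiguate : (C : Colouring) → Acc _<_ (weight C) → Hall C → Σ Colouring λ C′ → Hall C′ × Unambiguous C′
  unambiguate C (acc smaller) hall with ambiguity? C
  ... | no ¬ambiguity = C , hall , ¬ambiguity⇒unambiguous C ¬ambiguity
  ... | yes (x , _ , i , j , i≢j , x∈Ci , x∈Cj)
    with hall-split C (uncolour C i x) (uncolour C j x) (uncolour-split C x i≢j) hall
  ...   | inj₁ hall₁ = unambiguate (uncolour C i x) (smaller (weight-uncolour C x∈Ci)) hall₁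
  ...   | inj₂ hall₂ = unambiguate (uncolour C j x) (smaller (weight-uncolour C x∈Cj)) hall₂

  coloured : (C : Colouring) → Hall C → ∀ {x} → x ∈ I → ∃ λ j → x ∈ C j
  coloured C hall {x} x∈I with any? (λ j → x ∈? C j)
  ... | yes x∈Cj = x∈Cj
  ... | no uncoloured =
    contradiction (subst₂ _≤_ (∣⁅x⁆∣≡1 x) (sumFin-zero _ rank≡0) (hall ⁅ x ⁆ ⁅x⁆⊆I)) λ ()
    where
    ⁅x⁆⊆I : ⁅ x ⁆ ⊆ I
    ⁅x⁆⊆I z∈ = subst (_∈ I) (sym (x∈⁅y⁆⇒x≡y x z∈)) x∈I
    rank≡0 : ∀ j → rank (N j) (⁅ x ⁆ ∩ C j) ≡ 0
    rank≡0 j = rank-empty (N j) λ (z , z∈) → let z∈⁅x⁆ , z∈Cj = x∈p∩q⁻ ⁅ x ⁆ (C j) z∈ in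
      uncoloured (j , subst (_∈ C j) (x∈⁅y⁆⇒x≡y x z∈⁅x⁆) z∈Cj)

  partition : (C : Colouring) → Hall C → Unambiguous C →
    Σ (Fin k → Subset m) λ J → (∀ j → Indep (N j) (J j)) × unionFin k J ≡ I
  partition C hall unambiguous = J , indepJ , ⋃J≡I
    where
    J : Fin k → Subset m
    J j = I ∩ C j
    indepJ : ∀ j → Indep (N j) (J j)
    indepJ j = ≤-antisym (rank-bound (N j) (J j)) (begin
      ∣ J j ∣                        ≤⟨ hall (J j) (p∩q⊆p I (C j)) ⟩
      colouredRank C (J j)           ≡⟨ sumFin-single _ j others≡0 ⟩
      rank (N j) (J j ∩ C j)         ≤⟨ rank-mono (N j) _ _ (p∩q⊆p (J j) (C j)) ⟩
      rank (N j) (J j)               ∎)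
      where
      open ℕ.≤-Reasoning
      others≡0 : ∀ i → i ≢ j → rank (N i) (J j ∩ C i) ≡ 0
      others≡0 i i≢j = rank-empty (N i) λ (z , z∈) →
        let z∈Jj , z∈Ci = x∈p∩q⁻ (J j) (C i) z∈
            z∈I , z∈Cj = x∈p∩q⁻ I (C j) z∈Jj
        in i≢j (unambiguous z∈I z∈Ci z∈Cj)
    ⋃J≡I : unionFin k J ≡ I
    ⋃J≡I = ⊆-antisym
      (λ z∈ → let j , z∈Jj = ∈unionFin⁻ J z∈ in p∩q⊆p I (C j) z∈Jj)
      (λ z∈I → let j , z∈Cj = coloured C hall z∈I in ∈unionFin⁺ J j (x∈p∩q⁺ (z∈I , z∈Cj)))

rado : (N : Fin k → Matroid m) (I : Subset m) → (∀ P → P ⊆ I → ∣ P ∣ ≤ sumFin k (λ j → rank (N j) P)) →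
  Σ (Fin k → Subset m) λ J → (∀ j → Indep (N j) (J j)) × unionFin k J ≡ I
rado N I radoCondition =
  let C , hallC , unambiguous = unambiguate (const ⊤) (<-wellFounded _) hall⊤ in partition C hallC unambiguous
  where
  open Rado N I
  hall⊤ : Hall (const ⊤)
  hall⊤ P P⊆I = ≤-trans (radoCondition P P⊆I)
    (sumFin-mono _ _ λ j → rank-mono (N j) _ _ (⊆-reflexive (sym (∩-identityʳ P))))

theorem2p5 : (n : ℕ) (ρ : Subset n → ℕ) → IsIntPolymatroid ρ →
    (k : ℕ) (M : Fin k → Matroid n) →
    (∀ X → ρ X ≡ sumFin k (λ j → rank (M j) X)) →
    (m : ℕ) (π : Fin m → Fin n) → IsNaturalGround ρ π →
    (I : Subset m) →
      (IndepNatural ρ π I → IndepUnion k M π I) × (IndepUnion k M π I → IndepNatural ρ π I)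
theorem2p5 n ρ _ k M ρ≡Σrank m π _ I = fromNatural , toNatural
  where
  M′ : Fin k → Matroid m
  M′ j = parallelExtension (M j) π

  fromNatural : IndepNatural ρ π I → IndepUnion k M π I
  fromNatural indepI =
    let J , indepJ , ⋃J≡I = rado M′ I radoCondition in J , (λ j → indep⇒indepParallel (M j) π (indepJ j)) , ⋃J≡I
    where
    radoCondition : ∀ P → P ⊆ I → ∣ P ∣ ≤ sumFin k (λ j → rank (M′ j) P)
    radoCondition P P⊆I = begin
      ∣ P ∣                                    ≤⟨ p⊆q⇒∣p∣≤∣q∣ (λ z∈P → x∈p∩q⁺ (P⊆I z∈P , ⊆preimage-image π P z∈P)) ⟩
      ∣ I ∩ preimage π (image π P) ∣           ≤⟨ indepI (image π P) ⟩
      ρ (image π P)                            ≡⟨ ρ≡Σrank (image π P) ⟩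
      sumFin k (λ j → rank (M′ j) P)           ∎
      where open ℕ.≤-Reasoning

  toNatural : IndepUnion k M π I → IndepNatural ρ π I
  toNatural (J , indepJ , ⋃J≡I) A = begin
    ∣ I ∩ preimage π A ∣                         ≡⟨ cong (λ I → ∣ I ∩ preimage π A ∣) ⋃J≡I ⟨
    ∣ unionFin k J ∩ preimage π A ∣              ≤⟨ ∣unionFin∩∣≤sum-rank M′ J indepJ′ (preimage π A) ⟩
    sumFin k (λ j → rank (M′ j) (preimage π A))  ≤⟨ sumFin-mono _ _ (λ j → rank-mono (M j) _ _ (image-preimage⊆ π A)) ⟩
    sumFin k (λ j → rank (M j) A)                ≡⟨ ρ≡Σrank A ⟨
    ρ A                                          ∎
    where
    open ℕ.≤-Reasoning
    indepJ′ : ∀ j → Indep (M′ j) (J j)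
    indepJ′ j = indepParallel⇒indep (M j) π (indepJ j)
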